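{- Let $n\ge 1$ and let $\Gamma_n$ be the $n$-dimensional Fibonacci cube. There is a unique (unordered) pair of vertices $\{u,v\}$ of $\Gamma_n$ with $d(u,v)=\operatorname{diam}(\Gamma_n)$, namely (i) $u=(01)^{n/2}$ and $v=(10)^{n/2}$ if $n$ is even; (ii) $u=(01)^{(n-1)/2}0$ and $v=(10)^{(n-1)/2}1$ if $n$ is odd.
   Context: For $n\ge1$, the hypercube $Q_n$ has vertex set $B_n=\{b_1\cdots b_n: b_i\in\{0,1\}\}$, two strings adjacent iff they differ in exactly one coordinate. The Fibonacci cube $\Gamma_n$ is the subgraph of $Q_n$ induced by $\{b_1\cdots b_n\in B_n : b_ib_{i+1}=0 \text{ for all } i\in\{1,\dots,n-1\}\}$ (binary strings with no two consecutive 1s). $d(u,v)$ is the graph distance in $\Gamma_n$ and $\operatorname{diam}(\Gamma_n)$ is the maximum distance between two vertices. $(01)^k$ denotes the string $01$ repeated $k$ times. -}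

module Defs where

open import Data.Bool using (Bool; true; false)
open import Data.Nat using (ℕ; zero; suc; _≤_)
open import Data.Vec using (Vec; []; _∷_; _∷ʳ_)
open import Data.Product using (Σ; _×_; _,_)
open import Data.Sum using (_⊎_)
open import Relation.Binary.PropositionalEquality using (_≡_; _≢_)

-- Binary strings of length n: Vec Bool n  (false = 0, true = 1).

-- No two consecutive 1s: b_i b_{i+1} = 0 for all i.
data Fib : {n : ℕ} → Vec Bool n → Set where
  fib-[]  : Fib []
  fib-one : ∀ {b} → Fib (b ∷ [])
  fib-0   : ∀ {n} {c : Bool} {w : Vec Bool n} → Fib (c ∷ w) → Fib (false ∷ c ∷ w)
  fib-10  : ∀ {n} {w : Vec Bool n} → Fib (false ∷ w) → Fib (true ∷ false ∷ w)

differ : Bool → Bool → ℕ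
differ false true = 1
differ true false = 1
differ _ _ = 0

hamming : {n : ℕ} → Vec Bool n → Vec Bool n → ℕ
hamming [] [] = 0
hamming (x ∷ xs) (y ∷ ys) = differ x y Data.Nat.+ hamming xs ys

Adj : {n : ℕ} → Vec Bool n → Vec Bool n → Set
Adj u v = hamming u v ≡ 1

data Walk {n : ℕ} : Vec Bool n → Vec Bool n → ℕ → Set where
  stay : ∀ {u} → Fib u → Walk u u 0
  step : ∀ {u v w k} → Fib u → Adj u v → Walk v w k → Walk u w (suc k)

Dist : {n : ℕ} → Vec Bool n → Vec Bool n → ℕ → Set
Dist u v k = Walk u v k × (∀ m → Walk u v m → k ≤ m)

IsDiam : ℕ → ℕ → Set
IsDiam n D =
  Σ (Vec Bool n) (λ u → Σ (Vec Bool n) (λ v → Fib u × Fib v × Dist u v D))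
  × (∀ (u v : Vec Bool n) → Fib u → Fib v → ∀ k → Dist u v k → k ≤ D)

UniqueDiamPair : (n : ℕ) → Vec Bool n → Vec Bool n → Set
UniqueDiamPair n a b =
  Σ ℕ λ D → IsDiam n D × Fib a × Fib b × Dist a b D
    × (∀ (u v : Vec Bool n) → Fib u → Fib v → Dist u v D →
         (u ≡ a × v ≡ b) ⊎ (u ≡ b × v ≡ a))

-- doubling, defined so that lengths compute nicely: dbl k = 2k
dbl : ℕ → ℕ
dbl zero = zero
dbl (suc k) = suc (suc (dbl k))

rep01 : (k : ℕ) → Vec Bool (dbl k)
rep01 zero = []
rep01 (suc k) = false ∷ true ∷ rep01 k

rep10 : (k : ℕ) → Vec Bool (dbl k)
rep10 zero = []
rep10 (suc k) = true ∷ false ∷ rep10 k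

-- The Fibonacci strings are closed downward (turning 1s into 0s keeps them Fibonacci), so
-- from u one can walk down to u ∧ v and then up to v, flipping one bit per step; hence Γ_n is
-- an isometric subgraph of Q_n and d(u,v) is the Hamming distance.  This is at most n, with
-- equality exactly when v is the complement of u, and u and its complement both avoid 11
-- only if u alternates.
module Submission where

open import Defs
open import Data.Bool using (Bool; true; false; not; _∧_)
open import Data.Bool.Properties using (∧-comm)
open import Data.Nat using (ℕ; zero; suc; pred; _≤_; _+_; z≤n; s≤s)
open import Data.Nat.Properties
  using (≤-antisym; ≤-trans; +-mono-≤; +-suc; m≤n⇒m≤1+n; 1+n≰n; +-commutativeSemigroup)
open import Algebra.Properties.CommutativeSemigroup +-commutativeSemigroup using (interchange)
open import Data.Vec using (Vec; []; _∷_; _∷ʳ_; map; zipWith; iterate)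
open import Data.Vec.Properties using (zipWith-comm)
open import Data.Product using (_×_; _,_; ∃-syntax)
open import Data.Sum using (_⊎_; inj₁; inj₂)
open import Data.Empty using (⊥-elim)
open import Relation.Binary.PropositionalEquality

private
  variable
    n k : ℕ

hamming-self : (u : Vec Bool n) → hamming u u ≡ 0
hamming-self [] = refl
hamming-self (false ∷ u) = hamming-self u
hamming-self (true ∷ u) = hamming-self u

hamming≡0⇒≡ : (u v : Vec Bool n) → hamming u v ≡ 0 → u ≡ v
hamming≡0⇒≡ [] [] _ = refl
hamming≡0⇒≡ (false ∷ u) (false ∷ v) e = cong (false ∷_) (hamming≡0⇒≡ u v e)
hamming≡0⇒≡ (true ∷ u) (true ∷ v) e = cong (true ∷_) (hamming≡0⇒≡ u v e)

hamming-comm : (u v : Vec Bool n) → hamming u v ≡ hamming v u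
hamming-comm [] [] = refl
hamming-comm (false ∷ u) (false ∷ v) = hamming-comm u v
hamming-comm (false ∷ u) (true ∷ v) = cong suc (hamming-comm u v)
hamming-comm (true ∷ u) (false ∷ v) = cong suc (hamming-comm u v)
hamming-comm (true ∷ u) (true ∷ v) = hamming-comm u v

differ-triangle : ∀ x y z → differ x z ≤ differ x y + differ y z
differ-triangle false false false = z≤n
differ-triangle false false true = s≤s z≤n
differ-triangle false true false = z≤n
differ-triangle false true true = s≤s z≤n
differ-triangle true false false = s≤s z≤n
differ-triangle true false true = z≤n
differ-triangle true true false = s≤s z≤n
differ-triangle true true true = z≤n

hamming-triangle : (u v w : Vec Bool n) → hamming u w ≤ hamming u v + hamming v w
hamming-triangle [] [] [] = z≤n
hamming-triangle (x ∷ u) (y ∷ v) (z ∷ w) =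
  subst (differ x z + hamming u w ≤_)
    (interchange (differ x y) (differ y z) (hamming u v) (hamming v w))
    (+-mono-≤ (differ-triangle x y z) (hamming-triangle u v w))

hamming≤length : (u v : Vec Bool n) → hamming u v ≤ n
hamming≤length [] [] = z≤n
hamming≤length (false ∷ u) (false ∷ v) = m≤n⇒m≤1+n (hamming≤length u v)
hamming≤length (false ∷ u) (true ∷ v) = s≤s (hamming≤length u v)
hamming≤length (true ∷ u) (false ∷ v) = s≤s (hamming≤length u v)
hamming≤length (true ∷ u) (true ∷ v) = m≤n⇒m≤1+n (hamming≤length u v)

hamming≡length⇒complement : (u v : Vec Bool n) → hamming u v ≡ n → v ≡ map not u
hamming≡length⇒complement [] [] _ = refl
hamming≡length⇒complement (false ∷ u) (true ∷ v) e =
  cong (true ∷_) (hamming≡length⇒complement u v (cong pred e))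
hamming≡length⇒complement (true ∷ u) (false ∷ v) e =
  cong (false ∷_) (hamming≡length⇒complement u v (cong pred e))
hamming≡length⇒complement (false ∷ u) (false ∷ v) e =
  ⊥-elim (1+n≰n (subst (_≤ _) e (hamming≤length u v)))
hamming≡length⇒complement (true ∷ u) (true ∷ v) e =
  ⊥-elim (1+n≰n (subst (_≤ _) e (hamming≤length u v)))

infix 4 _≼_
data _≼_ : Vec Bool n → Vec Bool n → Set where
  []  : [] ≼ []
  0≼0 : {w u : Vec Bool n} → w ≼ u → false ∷ w ≼ false ∷ u
  0≼1 : {w u : Vec Bool n} → w ≼ u → false ∷ w ≼ true ∷ u
  1≼1 : {w u : Vec Bool n} → w ≼ u → true ∷ w ≼ true ∷ u

≼-refl : (u : Vec Bool n) → u ≼ u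
≼-refl [] = []
≼-refl (false ∷ u) = 0≼0 (≼-refl u)
≼-refl (true ∷ u) = 1≼1 (≼-refl u)

∧-≼ˡ : (u v : Vec Bool n) → zipWith _∧_ u v ≼ u
∧-≼ˡ [] [] = []
∧-≼ˡ (false ∷ u) (y ∷ v) = 0≼0 (∧-≼ˡ u v)
∧-≼ˡ (true ∷ u) (false ∷ v) = 0≼1 (∧-≼ˡ u v)
∧-≼ˡ (true ∷ u) (true ∷ v) = 1≼1 (∧-≼ˡ u v)

∧-≼ʳ : (u v : Vec Bool n) → zipWith _∧_ u v ≼ v
∧-≼ʳ u v = subst (_≼ v) (zipWith-comm {f = _∧_} {g = _∧_} ∧-comm v u) (∧-≼ˡ v u)

hamming-via-∧ : (u v : Vec Bool n) →
  hamming u (zipWith _∧_ u v) + hamming v (zipWith _∧_ u v) ≡ hamming u v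
hamming-via-∧ [] [] = refl
hamming-via-∧ (false ∷ u) (false ∷ v) = hamming-via-∧ u v
hamming-via-∧ (false ∷ u) (true ∷ v) = trans (+-suc _ _) (cong suc (hamming-via-∧ u v))
hamming-via-∧ (true ∷ u) (false ∷ v) = cong suc (hamming-via-∧ u v)
hamming-via-∧ (true ∷ u) (true ∷ v) = hamming-via-∧ u v

Fib-downward : {w u : Vec Bool n} → w ≼ u → Fib u → Fib w
Fib-downward [] fib-[] = fib-[]
Fib-downward {w = _ ∷ []} _ fib-one = fib-one
Fib-downward (0≼0 w≼u@(0≼0 _)) (fib-0 f) = fib-0 (Fib-downward w≼u f)
Fib-downward (0≼0 w≼u@(0≼1 _)) (fib-0 f) = fib-0 (Fib-downward w≼u f)
Fib-downward (0≼0 w≼u@(1≼1 _)) (fib-0 f) = fib-0 (Fib-downward w≼u f)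
Fib-downward (0≼1 w≼u@(0≼0 _)) (fib-10 f) = fib-0 (Fib-downward w≼u f)
Fib-downward (1≼1 w≼u@(0≼0 _)) (fib-10 f) = fib-10 (Fib-downward w≼u f)

walk-++ : {u v w : Vec Bool n} {a b : ℕ} → Walk u v a → Walk v w b → Walk u w (a + b)
walk-++ (stay _) q = q
walk-++ (step f a p) q = step f a (walk-++ p q)

walk-∷ʳ : {u v w : Vec Bool n} → Walk u v k → Fib w → Adj v w → Walk u w (suc k)
walk-∷ʳ (stay fu) fw a = step fu a (stay fw)
walk-∷ʳ (step fu a p) fw b = step fu a (walk-∷ʳ p fw b)

walk-reverse : {u v : Vec Bool n} → Walk u v k → Walk v u k
walk-reverse (stay f) = stay f
walk-reverse {u = u} (step {v = v} fu a p) =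
  walk-∷ʳ (walk-reverse p) fu (trans (hamming-comm v u) a)

≼-flip-one : {w u : Vec Bool n} → w ≼ u → hamming u w ≡ suc k →
  ∃[ u′ ] w ≼ u′ × u′ ≼ u × Adj u u′ × hamming u′ w ≡ k
≼-flip-one (0≼0 w≼u) e with ≼-flip-one w≼u e
... | u′ , w≼u′ , u′≼u , a , d = false ∷ u′ , 0≼0 w≼u′ , 0≼0 u′≼u , a , d
≼-flip-one (1≼1 w≼u) e with ≼-flip-one w≼u e
... | u′ , w≼u′ , u′≼u , a , d = true ∷ u′ , 1≼1 w≼u′ , 1≼1 u′≼u , a , d
≼-flip-one {u = true ∷ u} (0≼1 w≼u) e =
  false ∷ u , 0≼0 w≼u , 0≼1 (≼-refl u) , cong suc (hamming-self u) , cong pred e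

walk-down : {w u : Vec Bool n} → w ≼ u → Fib u → hamming u w ≡ k → Walk u w k
walk-down {k = zero} {w = w} {u} _ fu e rewrite hamming≡0⇒≡ u w e = stay fu
walk-down {k = suc k} w≼u fu e with ≼-flip-one w≼u e
... | u′ , w≼u′ , u′≼u , a , d = step fu a (walk-down w≼u′ (Fib-downward u′≼u fu) d)

walk-hamming : {u v : Vec Bool n} → Fib u → Fib v → Walk u v (hamming u v)
walk-hamming {u = u} {v} fu fv =
  subst (Walk u v) (hamming-via-∧ u v)
    (walk-++ (walk-down (∧-≼ˡ u v) fu refl) (walk-reverse (walk-down (∧-≼ʳ u v) fv refl)))

hamming≤walk-length : {u v : Vec Bool n} → Walk u v k → hamming u v ≤ k
hamming≤walk-length {u = u} (stay _) = subst (_≤ 0) (sym (hamming-self u)) z≤n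
hamming≤walk-length {u = u} {w} (step {v = v} _ a p) =
  ≤-trans (hamming-triangle u v w)
    (subst (λ t → t + hamming v w ≤ suc _) (sym a) (s≤s (hamming≤walk-length p)))

Dist-hamming : {u v : Vec Bool n} → Fib u → Fib v → Dist u v (hamming u v)
Dist-hamming fu fv = walk-hamming fu fv , λ _ → hamming≤walk-length

Dist⇒≡hamming : {u v : Vec Bool n} → Fib u → Fib v → Dist u v k → k ≡ hamming u v
Dist⇒≡hamming fu fv (p , minimal) =
  ≤-antisym (minimal _ (walk-hamming fu fv)) (hamming≤walk-length p)

Fib-alternating : ∀ b n → Fib (iterate not b n)
Fib-alternating b zero = fib-[]
Fib-alternating b (suc zero) = fib-one
Fib-alternating false (suc (suc n)) = fib-0 (Fib-alternating true (suc n))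
Fib-alternating true (suc (suc n)) = fib-10 (Fib-alternating false (suc n))

hamming-alternating : ∀ b n → hamming (iterate not b n) (iterate not (not b) n) ≡ n
hamming-alternating b zero = refl
hamming-alternating false (suc n) = cong suc (hamming-alternating true n)
hamming-alternating true (suc n) = cong suc (hamming-alternating false n)

map-not-alternating : ∀ b n → map not (iterate not b n) ≡ iterate not (not b) n
map-not-alternating b zero = refl
map-not-alternating false (suc n) = cong (true ∷_) (map-not-alternating true n)
map-not-alternating true (suc n) = cong (false ∷_) (map-not-alternating false n)

Fib-complement⇒alternating : (x : Bool) (u : Vec Bool n) →
  Fib (x ∷ u) → Fib (map not (x ∷ u)) → x ∷ u ≡ iterate not x (suc n)
Fib-complement⇒alternating x [] _ _ = refl
Fib-complement⇒alternating false (true ∷ u) (fib-0 f) (fib-10 g) =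
  cong (false ∷_) (Fib-complement⇒alternating true u f g)
Fib-complement⇒alternating true (false ∷ u) (fib-10 f) (fib-0 g) =
  cong (true ∷_) (Fib-complement⇒alternating false u f g)

antipodal⇒alternating : (u v : Vec Bool n) → Fib u → Fib v → hamming u v ≡ n →
  ∃[ b ] u ≡ iterate not b n × v ≡ iterate not (not b) n
antipodal⇒alternating [] [] _ _ _ = false , refl , refl
antipodal⇒alternating {suc n} (x ∷ u) v fu fv e
  with refl ← hamming≡length⇒complement (x ∷ u) v e =
  x , u-alt , trans (cong (map not) u-alt) (map-not-alternating x (suc n))
  where
  u-alt : x ∷ u ≡ iterate not x (suc n)
  u-alt = Fib-complement⇒alternating x u fu fv

alternating-unique-diametral-pair :
  ∀ n → UniqueDiamPair n (iterate not false n) (iterate not true n)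
alternating-unique-diametral-pair n = n , diameter , fib-a , fib-b , dist-ab , diametral-pairs
  where
  fib-a : Fib (iterate not false n)
  fib-a = Fib-alternating false n

  fib-b : Fib (iterate not true n)
  fib-b = Fib-alternating true n

  dist-ab : Dist (iterate not false n) (iterate not true n) n
  dist-ab = subst (Dist _ _) (hamming-alternating false n) (Dist-hamming fib-a fib-b)

  diameter : IsDiam n n
  diameter = (_ , _ , fib-a , fib-b , dist-ab) ,
             λ u v fu fv k d → subst (_≤ n) (sym (Dist⇒≡hamming fu fv d)) (hamming≤length u v)

  diametral-pairs : ∀ (u v : Vec Bool n) → Fib u → Fib v → Dist u v n →
    (u ≡ iterate not false n × v ≡ iterate not true n)
    ⊎ (u ≡ iterate not true n × v ≡ iterate not false n)
  diametral-pairs u v fu fv d with antipodal⇒alternating u v fu fv (sym (Dist⇒≡hamming fu fv d))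
  ... | false , u≡ , v≡ = inj₁ (u≡ , v≡)
  ... | true , u≡ , v≡ = inj₂ (u≡ , v≡)

rep01≡alternating : ∀ k → rep01 k ≡ iterate not false (dbl k)
rep01≡alternating zero = refl
rep01≡alternating (suc k) = cong (λ w → false ∷ true ∷ w) (rep01≡alternating k)

rep10≡alternating : ∀ k → rep10 k ≡ iterate not true (dbl k)
rep10≡alternating zero = refl
rep10≡alternating (suc k) = cong (λ w → true ∷ false ∷ w) (rep10≡alternating k)

alternating-∷ʳ : ∀ b k → iterate not b (dbl k) ∷ʳ b ≡ iterate not b (suc (dbl k))
alternating-∷ʳ b zero = refl
alternating-∷ʳ false (suc k) = cong (λ w → false ∷ true ∷ w) (alternating-∷ʳ false k)
alternating-∷ʳ true (suc k) = cong (λ w → true ∷ false ∷ w) (alternating-∷ʳ true k)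

proposition1 : (∀ (k : ℕ) → 1 ≤ k → UniqueDiamPair (dbl k) (rep01 k) (rep10 k))
    × (∀ (k : ℕ) → UniqueDiamPair (suc (dbl k)) (rep01 k ∷ʳ false) (rep10 k ∷ʳ true))
proposition1 = even , odd
  where
  even : ∀ k → 1 ≤ k → UniqueDiamPair (dbl k) (rep01 k) (rep10 k)
  even k _ = subst₂ (UniqueDiamPair (dbl k))
    (sym (rep01≡alternating k)) (sym (rep10≡alternating k))
    (alternating-unique-diametral-pair (dbl k))

  odd : ∀ k → UniqueDiamPair (suc (dbl k)) (rep01 k ∷ʳ false) (rep10 k ∷ʳ true)
  odd k = subst₂ (UniqueDiamPair (suc (dbl k)))
    (sym (trans (cong (_∷ʳ false) (rep01≡alternating k)) (alternating-∷ʳ false k)))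
    (sym (trans (cong (_∷ʳ true) (rep10≡alternating k)) (alternating-∷ʳ true k)))
    (alternating-unique-diametral-pair (suc (dbl k)))
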